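{- Let $\lambda,m,n,h,k$ be positive integers with $m\ge k$, $n\ge h$, $nk=mh$ and $2=\frac{2nk}{\lambda}+1$ (i.e. $\lambda=2nk$), and suppose $h\cdot k$ is odd. Then there exists a ${}^\lambda\mathrm{NH}(m,n;h,k)$ over $\mathbb{Z}_2$ (relative to the trivial subgroup).
   Context: An $m\times n$ partially filled (p.f.) array over a group $G$ (written additively) is an $m\times n$ matrix each of whose cells is either empty or contains an element of $G$. For a subgroup $J$ of order $t$, a $\lambda$-fold non-zero sum Heffter array ${}^\lambda\mathrm{NH}_t(m,n;h,k)$ over $G$ relative to $J$ is an $m\times n$ p.f. array $A$ over $G$ such that: (a) each row contains exactly $h$ filled cells and each column exactly $k$ filled cells; (b) the multiset obtained by taking, for every filled cell with entry $x$, the two elements $x$ and $-x$ (with multiplicity, so an involution contributes twice), is exactly the multiset containing each element of $G\setminus J$ exactly $\lambda$ times; (c) each row sum (left to right) and each column sum (top to bottom) is nonzero. When $t=1$ ($J$ trivial) the subscript is omitted: ${}^\lambda\mathrm{NH}(m,n;h,k)$. -}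

module Defs where

open import Data.Nat using (ℕ; zero; suc; _+_)
open import Data.Fin using (Fin; zero; suc)
open import Data.Maybe using (Maybe; just; nothing)
open import Data.Product using (_×_)
open import Relation.Nullary using (¬_; Dec; yes; no)
open import Relation.Binary.PropositionalEquality using (_≡_)
open import Relation.Binary.Definitions using (DecidableEquality)

Σℕ : (k : ℕ) → (Fin k → ℕ) → ℕ
Σℕ zero    f = 0
Σℕ (suc k) f = f zero + Σℕ k (λ i → f (suc i))

PFArray : Set → ℕ → ℕ → Set
PFArray G m n = Fin m → Fin n → Maybe G

filled? : {G : Set} → Maybe G → ℕ
filled? nothing  = 0
filled? (just _) = 1

record AddGroupData (G : Set) : Set where
  field
    _⊕_  : G → G → G
    𝟘    : G
    ⊖_   : G → G
    _≟G_ : DecidableEquality G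

module _ {G : Set} (GD : AddGroupData G) where
  open AddGroupData GD

  δ : G → G → ℕ
  δ x g with x ≟G g
  ... | yes _ = 1
  ... | no  _ = 0

  cellCount : G → Maybe G → ℕ
  cellCount g nothing  = 0
  cellCount g (just x) = δ x g + δ (⊖ x) g

  sumCells : (k : ℕ) → (Fin k → Maybe G) → G
  sumCells zero    f = 𝟘
  sumCells (suc k) f with f zero
  ... | nothing = sumCells k (λ i → f (suc i))
  ... | just x  = x ⊕ sumCells k (λ i → f (suc i))

  record IsNH (λ' m n h k : ℕ) (A : PFArray G m n) : Set where
    field
      rowFilled : ∀ i → Σℕ n (λ j → filled? (A i j)) ≡ h
      colFilled : ∀ j → Σℕ m (λ i → filled? (A i j)) ≡ k
      -- multiplicity of g in ⋃_{filled cells x} {x, -x}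
      multJ     : ∀ g → g ≡ 𝟘 → Σℕ m (λ i → Σℕ n (λ j → cellCount g (A i j))) ≡ 0
      multG∖J   : ∀ g → ¬ (g ≡ 𝟘) → Σℕ m (λ i → Σℕ n (λ j → cellCount g (A i j))) ≡ λ'
      rowSum    : ∀ i → ¬ (sumCells n (λ j → A i j) ≡ 𝟘)
      colSum    : ∀ j → ¬ (sumCells m (λ i → A i j) ≡ 𝟘)

_+₂_ : Fin 2 → Fin 2 → Fin 2
zero     +₂ y        = y
suc zero +₂ zero     = suc zero
suc zero +₂ suc zero = zero

-₂_ : Fin 2 → Fin 2
-₂ x = x

ℤ₂ : AddGroupData (Fin 2)
ℤ₂ = record { _⊕_ = _+₂_ ; 𝟘 = zero ; ⊖_ = -₂_ ; _≟G_ = Data.Fin._≟_ }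

-- Over ℤ₂ with J trivial the only admissible entry is 1, an involution
-- contributing twice to the multiset, so λ = 2nk forces every filled cell to
-- hold 1; the array is then determined by its support, and a row or column sum
-- is the parity of its number of filled cells, nonzero because h and k are odd.
-- It remains to find an m × n 0/1 pattern with h ones per row and k per column.
-- With d = gcd(m, n), m = a d and n = b d, the relation n k = m h reads
-- b k = a h with a, b coprime, so h = b s and k = a s for some s ≤ d.
-- Cell (i, j) is filled iff (i + j) mod d < s: every row and column runs
-- through b resp. a full periods of this d-periodic band, each holding s ones.
module Submission where

open import Defs
open import Algebra.Properties.CommutativeSemigroup as CommSemigroupProperties using ()
open import Data.Bool using (Bool; true; false)
open import Data.Empty using (⊥-elim)
open import Data.Fin using (Fin; zero; suc; toℕ)
open import Data.Maybe using (Maybe; just; nothing)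
open import Data.Nat
  using (ℕ; zero; suc; _+_; _*_; _≤_; _<_; _≥_; z≤n; s≤s; _<ᵇ_; _%_; NonZero; ≢-nonZero; ≢-nonZero⁻¹)
open import Data.Nat.Coprimality using (Coprime; GCD≡1⇒coprime; coprime-divisor)
open import Data.Nat.Divisibility using (_∣_; divides; ∣-refl; ∣m∣n⇒∣m+n; ∣m⇒∣m*n; ∣n⇒∣m*n)
open import Data.Nat.DivMod using ([m+n]%n≡m%n; m<n⇒m%n≡m)
open import Data.Nat.GCD using (gcd; gcd-GCD; gcd[m,n]≢0; GCD-*; module GCD)
open import Data.Nat.Properties
open import Data.Product using (Σ; _,_)
open import Data.Sum using (inj₁)
open import Function using (_∘_)
open import Relation.Nullary using (¬_)
open import Relation.Binary.PropositionalEquality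
  using (_≡_; refl; sym; trans; cong; cong₂; subst; subst₂; module ≡-Reasoning)
open ≡-Reasoning

𝟙 : Bool → ℕ
𝟙 true  = 1
𝟙 false = 0

sumBelow : ℕ → (ℕ → ℕ) → ℕ
sumBelow zero    f = 0
sumBelow (suc n) f = f 0 + sumBelow n (f ∘ suc)

sumBelow-cong : ∀ n {f g : ℕ → ℕ} → (∀ x → x < n → f x ≡ g x) → sumBelow n f ≡ sumBelow n g
sumBelow-cong zero    f≗g = refl
sumBelow-cong (suc n) f≗g = cong₂ _+_ (f≗g 0 (s≤s z≤n)) (sumBelow-cong n (λ x x<n → f≗g (suc x) (s≤s x<n)))

sumBelow-+ : ∀ a b (f : ℕ → ℕ) → sumBelow (a + b) f ≡ sumBelow a f + sumBelow b (λ x → f (a + x))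
sumBelow-+ zero    b f = refl
sumBelow-+ (suc a) b f = trans (cong (f 0 +_) (sumBelow-+ a b (f ∘ suc))) (sym (+-assoc (f 0) _ _))

sumBelow-suc : ∀ n (f : ℕ → ℕ) → sumBelow (suc n) f ≡ sumBelow n f + f n
sumBelow-suc zero    f = +-identityʳ (f 0)
sumBelow-suc (suc n) f = trans (cong (f 0 +_) (sumBelow-suc n (f ∘ suc))) (sym (+-assoc (f 0) _ _))

sumBelow-zero : ∀ n → sumBelow n (λ _ → 0) ≡ 0
sumBelow-zero zero    = refl
sumBelow-zero (suc n) = sumBelow-zero n

sumBelow-<ᵇ : ∀ {s d} → s ≤ d → sumBelow d (λ x → 𝟙 (x <ᵇ s)) ≡ s
sumBelow-<ᵇ {zero}  {d} _         = sumBelow-zero d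
sumBelow-<ᵇ {suc s}     (s≤s s≤d) = cong suc (sumBelow-<ᵇ s≤d)

Periodic : ℕ → (ℕ → ℕ) → Set
Periodic d f = ∀ x → f (d + x) ≡ f x

periodic-suc : ∀ {d f} → Periodic d f → Periodic d (f ∘ suc)
periodic-suc {d} {f} p x = trans (cong f (sym (+-suc d x))) (p (suc x))

periodic-shift : ∀ {d f} c → Periodic d f → Periodic d (λ x → f (c + x))
periodic-shift {d} {f} c p x =
  trans (cong f (CommSemigroupProperties.x∙yz≈y∙xz +-commutativeSemigroup c d x)) (p (c + x))

sumBelow-periodic-suc : ∀ {d f} → Periodic d f → sumBelow d (f ∘ suc) ≡ sumBelow d f
sumBelow-periodic-suc {d} {f} p = +-cancelʳ-≡ (f 0) _ _ (begin
  sumBelow d (f ∘ suc) + f 0  ≡⟨ +-comm _ (f 0) ⟩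
  sumBelow (suc d) f          ≡⟨ sumBelow-suc d f ⟩
  sumBelow d f + f d          ≡⟨ cong (λ x → sumBelow d f + f x) (sym (+-identityʳ d)) ⟩
  sumBelow d f + f (d + 0)    ≡⟨ cong (sumBelow d f +_) (p 0) ⟩
  sumBelow d f + f 0          ∎)

sumBelow-periodic-rotate : ∀ {d f} c → Periodic d f → sumBelow d (λ x → f (c + x)) ≡ sumBelow d f
sumBelow-periodic-rotate         zero    p = refl
sumBelow-periodic-rotate {f = f} (suc c) p =
  trans (sumBelow-periodic-rotate {f = f ∘ suc} c (periodic-suc p)) (sumBelow-periodic-suc p)

sumBelow-periods : ∀ {d f} q → Periodic d f → sumBelow (q * d) f ≡ q * sumBelow d f
sumBelow-periods         zero    p = refl
sumBelow-periods {d} {f} (suc q) p = begin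
  sumBelow (d + q * d) f                             ≡⟨ sumBelow-+ d (q * d) f ⟩
  sumBelow d f + sumBelow (q * d) (λ x → f (d + x))  ≡⟨ cong (sumBelow d f +_) (sumBelow-cong (q * d) (λ x _ → p x)) ⟩
  sumBelow d f + sumBelow (q * d) f                  ≡⟨ cong (sumBelow d f +_) (sumBelow-periods q p) ⟩
  sumBelow d f + q * sumBelow d f                    ∎

sumBelow-periodic-window : ∀ {d f} q c → Periodic d f →
                           sumBelow (q * d) (λ x → f (c + x)) ≡ q * sumBelow d f
sumBelow-periodic-window {d} {f} q c p = begin
  sumBelow (q * d) (λ x → f (c + x))  ≡⟨ sumBelow-periods q (periodic-shift c p) ⟩
  q * sumBelow d (λ x → f (c + x))    ≡⟨ cong (q *_) (sumBelow-periodic-rotate c p) ⟩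
  q * sumBelow d f                    ∎

Σℕ-toℕ : ∀ n (f : ℕ → ℕ) → Σℕ n (f ∘ toℕ) ≡ sumBelow n f
Σℕ-toℕ zero    f = refl
Σℕ-toℕ (suc n) f = cong (f 0 +_) (Σℕ-toℕ n (f ∘ suc))

Σℕ-cong : ∀ n {f g : Fin n → ℕ} → (∀ i → f i ≡ g i) → Σℕ n f ≡ Σℕ n g
Σℕ-cong zero    f≗g = refl
Σℕ-cong (suc n) f≗g = cong₂ _+_ (f≗g zero) (Σℕ-cong n (f≗g ∘ suc))

Σℕ-const : ∀ n {c} {f : Fin n → ℕ} → (∀ i → f i ≡ c) → Σℕ n f ≡ n * c
Σℕ-const zero    f≡c = refl
Σℕ-const (suc n) f≡c = cong₂ _+_ (f≡c zero) (Σℕ-const n (f≡c ∘ suc))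

Σℕ-*ˡ : ∀ n c (f : Fin n → ℕ) → Σℕ n (λ i → c * f i) ≡ c * Σℕ n f
Σℕ-*ˡ zero    c f = sym (*-zeroʳ c)
Σℕ-*ˡ (suc n) c f = trans (cong (c * f zero +_) (Σℕ-*ˡ n c (f ∘ suc))) (sym (*-distribˡ-+ c _ _))

parity : ℕ → Fin 2
parity zero    = zero
parity (suc n) = suc zero +₂ parity n

parity≡0⇒2∣ : ∀ n → parity n ≡ zero → 2 ∣ n
parity≡0⇒2∣ zero          _   = divides 0 refl
parity≡0⇒2∣ (suc zero)    ()
parity≡0⇒2∣ (suc (suc n)) eq  = ∣m∣n⇒∣m+n ∣-refl (parity≡0⇒2∣ n (trans (sym (1+₂1+₂x (parity n))) eq))
  where
  1+₂1+₂x : ∀ x → suc zero +₂ (suc zero +₂ x) ≡ x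
  1+₂1+₂x zero       = refl
  1+₂1+₂x (suc zero) = refl

oneIf : Bool → Maybe (Fin 2)
oneIf true  = just (suc zero)
oneIf false = nothing

sumCells-oneIf : ∀ k (b : Fin k → Bool) → sumCells ℤ₂ k (oneIf ∘ b) ≡ parity (Σℕ k (𝟙 ∘ b))
sumCells-oneIf zero    b = refl
sumCells-oneIf (suc k) b with b zero
... | true  = cong (suc zero +₂_) (sumCells-oneIf k (b ∘ suc))
... | false = sumCells-oneIf k (b ∘ suc)

filled?-oneIf : ∀ b → filled? (oneIf b) ≡ 𝟙 b
filled?-oneIf true  = refl
filled?-oneIf false = refl

cellCount-zero-oneIf : ∀ b → cellCount ℤ₂ zero (oneIf b) ≡ 0
cellCount-zero-oneIf true  = refl
cellCount-zero-oneIf false = refl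

cellCount-one-oneIf : ∀ b → cellCount ℤ₂ (suc zero) (oneIf b) ≡ 2 * 𝟙 b
cellCount-one-oneIf true  = refl
cellCount-one-oneIf false = refl

onesAt : ∀ {m n} → (Fin m → Fin n → Bool) → PFArray (Fin 2) m n
onesAt B i j = oneIf (B i j)

onesAt-isNH : ∀ {m n h k} (B : Fin m → Fin n → Bool) →
              (∀ i → Σℕ n (λ j → 𝟙 (B i j)) ≡ h) → (∀ j → Σℕ m (λ i → 𝟙 (B i j)) ≡ k) →
              ¬ (2 ∣ h) → ¬ (2 ∣ k) → IsNH ℤ₂ (2 * (m * h)) m n h k (onesAt B)
onesAt-isNH {m} {n} {h} {k} B rows cols h-odd k-odd = record
  { rowFilled = λ i → trans (Σℕ-cong n (filled?-oneIf ∘ B i)) (rows i)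
  ; colFilled = λ j → trans (Σℕ-cong m (λ i → filled?-oneIf (B i j))) (cols j)
  ; multJ     = λ { g refl → multiplicity-zero }
  ; multG∖J   = multiplicity-nonzero
  ; rowSum    = λ i sum≡0 → h-odd (parity≡0⇒2∣ h (rowParity i sum≡0))
  ; colSum    = λ j sum≡0 → k-odd (parity≡0⇒2∣ k (colParity j sum≡0))
  }
  where
  multiplicity : Fin 2 → ℕ
  multiplicity g = Σℕ m (λ i → Σℕ n (λ j → cellCount ℤ₂ g (onesAt B i j)))

  multiplicity-zero : multiplicity zero ≡ 0
  multiplicity-zero = trans (Σℕ-const m (λ i → trans (Σℕ-const n (cellCount-zero-oneIf ∘ B i)) (*-zeroʳ n)))
                            (*-zeroʳ m)

  multiplicity-nonzero : ∀ g → ¬ (g ≡ zero) → multiplicity g ≡ 2 * (m * h)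
  multiplicity-nonzero zero       g≢0 = ⊥-elim (g≢0 refl)
  multiplicity-nonzero (suc zero) _   = begin
    multiplicity (suc zero)  ≡⟨ Σℕ-const m (λ i → trans (Σℕ-cong n (cellCount-one-oneIf ∘ B i))
                                                  (trans (Σℕ-*ˡ n 2 (𝟙 ∘ B i)) (cong (2 *_) (rows i)))) ⟩
    m * (2 * h)              ≡⟨ CommSemigroupProperties.x∙yz≈y∙xz *-commutativeSemigroup m 2 h ⟩
    2 * (m * h)              ∎

  rowParity : ∀ i → sumCells ℤ₂ n (onesAt B i) ≡ zero → parity h ≡ zero
  rowParity i sum≡0 = trans (cong parity (sym (rows i))) (trans (sym (sumCells-oneIf n (B i))) sum≡0)

  colParity : ∀ j → sumCells ℤ₂ m (λ i → onesAt B i j) ≡ zero → parity k ≡ zero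
  colParity j sum≡0 = trans (cong parity (sym (cols j))) (trans (sym (sumCells-oneIf m (λ i → B i j))) sum≡0)

module Band (d s : ℕ) .{{_ : NonZero d}} (s≤d : s ≤ d) where

  band : ℕ → Bool
  band x = x % d <ᵇ s

  band-periodic : Periodic d (𝟙 ∘ band)
  band-periodic x = cong (λ y → 𝟙 (y <ᵇ s)) (trans (cong (_% d) (+-comm d x)) ([m+n]%n≡m%n x d))

  sumBelow-band : sumBelow d (𝟙 ∘ band) ≡ s
  sumBelow-band = trans (sumBelow-cong d (λ x x<d → cong (λ y → 𝟙 (y <ᵇ s)) (m<n⇒m%n≡m x<d)))
                        (sumBelow-<ᵇ s≤d)

  circulant : ∀ {m n} → Fin m → Fin n → Bool
  circulant i j = band (toℕ i + toℕ j)

  circulant-row : ∀ {m} n q → n ≡ q * d → (i : Fin m) → Σℕ n (λ j → 𝟙 (circulant i j)) ≡ q * s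
  circulant-row n q n≡qd i = begin
    Σℕ n (λ j → 𝟙 (circulant i j))            ≡⟨ Σℕ-toℕ n (λ y → 𝟙 (band (toℕ i + y))) ⟩
    sumBelow n (λ y → 𝟙 (band (toℕ i + y)))   ≡⟨ cong (λ l → sumBelow l (λ y → 𝟙 (band (toℕ i + y)))) n≡qd ⟩
    sumBelow (q * d) (λ y → 𝟙 (band (toℕ i + y)))
                                              ≡⟨ sumBelow-periodic-window q (toℕ i) band-periodic ⟩
    q * sumBelow d (𝟙 ∘ band)                 ≡⟨ cong (q *_) sumBelow-band ⟩
    q * s                                     ∎

  circulant-column : ∀ m q {n} → m ≡ q * d → (j : Fin n) → Σℕ m (λ i → 𝟙 (circulant i j)) ≡ q * s
  circulant-column m q m≡qd j =
    trans (Σℕ-cong m (λ i → cong (𝟙 ∘ band) (+-comm (toℕ i) (toℕ j)))) (circulant-row m q m≡qd j)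

record BlockShape (m n h k : ℕ) : Set where
  field
    d a b s     : ℕ
    d≢0         : NonZero d
    m≡ad        : m ≡ a * d
    n≡bd        : n ≡ b * d
    h≡bs        : h ≡ b * s
    k≡as        : k ≡ a * s
    s≤d         : s ≤ d

blockShape : ∀ m n h k → .{{NonZero m}} → .{{NonZero n}} → n ≥ h → n * k ≡ m * h → BlockShape m n h k
blockShape m n h k n≥h nk≡mh with gcd m n | gcd-GCD m n | gcd[m,n]≢0 m n (inj₁ (≢-nonZero⁻¹ m))
... | d | gcd-mn | gcd≢0 with GCD.commonDivisor gcd-mn
... | (divides a m≡ad , divides b n≡bd) = shape
  where
  instance
    nonZero-d : NonZero d
    nonZero-d = ≢-nonZero gcd≢0
    nonZero-b : NonZero b
    nonZero-b = ≢-nonZero (λ b≡0 → ≢-nonZero⁻¹ n (trans n≡bd (cong (_* d) b≡0)))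

  coprime-ba : Coprime b a
  coprime-ba = GCD≡1⇒coprime (GCD-* (subst₂ (λ x y → GCD.GCD x y (1 * d)) n≡bd m≡ad
                                        (subst (GCD.GCD n m) (sym (*-identityˡ d)) (GCD.sym gcd-mn))))

  ah≡kb : a * h ≡ k * b
  ah≡kb = *-cancelʳ-≡ (a * h) (k * b) d (begin
    a * h * d   ≡⟨ CommSemigroupProperties.xy∙z≈xz∙y *-commutativeSemigroup a h d ⟩
    a * d * h   ≡⟨ cong (_* h) (sym m≡ad) ⟩
    m * h       ≡⟨ sym nk≡mh ⟩
    n * k       ≡⟨ cong (_* k) n≡bd ⟩
    b * d * k   ≡⟨ CommSemigroupProperties.xy∙z≈z∙xy *-commutativeSemigroup b d k ⟩
    k * (b * d) ≡⟨ sym (*-assoc k b d) ⟩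
    k * b * d   ∎)

  shape : BlockShape m n h k
  shape with coprime-divisor coprime-ba (divides k ah≡kb)
  ... | divides s h≡sb = record
    { d = d ; a = a ; b = b ; s = s ; d≢0 = nonZero-d
    ; m≡ad = m≡ad ; n≡bd = n≡bd
    ; h≡bs = trans h≡sb (*-comm s b)
    ; k≡as = *-cancelʳ-≡ k (a * s) b (begin
        k * b       ≡⟨ sym ah≡kb ⟩
        a * h       ≡⟨ cong (a *_) h≡sb ⟩
        a * (s * b) ≡⟨ sym (*-assoc a s b) ⟩
        a * s * b   ∎)
    ; s≤d = *-cancelʳ-≤ s d b (subst₂ _≤_ h≡sb (trans n≡bd (*-comm b d)) n≥h)
    }

theorem2p2 : (λ' m n h k : ℕ) → NonZero λ' → NonZero m → NonZero n → NonZero h → NonZero k →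
    m ≥ k → n ≥ h → n * k ≡ m * h → λ' ≡ 2 * (n * k) → ¬ (2 ∣ h * k) →
    Σ (PFArray (Fin 2) m n) (λ A → IsNH ℤ₂ λ' m n h k A)
theorem2p2 λ' m n h k _ m≢0 n≢0 _ _ _ n≥h nk≡mh λ'≡2nk hk-odd =
  onesAt circulant , subst (λ l → IsNH ℤ₂ l m n h k (onesAt circulant)) 2mh≡λ'
                           (onesAt-isNH circulant rows columns h-odd k-odd)
  where
  open BlockShape (blockShape m n h k {{m≢0}} {{n≢0}} n≥h nk≡mh)
  open Band d s {{d≢0}} s≤d

  rows : ∀ i → Σℕ n (λ j → 𝟙 (circulant i j)) ≡ h
  rows i = trans (circulant-row n b n≡bd i) (sym h≡bs)

  columns : ∀ j → Σℕ m (λ i → 𝟙 (circulant i j)) ≡ k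
  columns j = trans (circulant-column m a m≡ad j) (sym k≡as)

  h-odd : ¬ (2 ∣ h)
  h-odd 2∣h = hk-odd (∣m⇒∣m*n k 2∣h)

  k-odd : ¬ (2 ∣ k)
  k-odd 2∣k = hk-odd (∣n⇒∣m*n h 2∣k)

  2mh≡λ' : 2 * (m * h) ≡ λ'
  2mh≡λ' = sym (trans λ'≡2nk (cong (2 *_) nk≡mh))
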